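{- Let $n\ge 2$ and $G=P_2\,\square\,P_n$. Then $G$ is $(3,1/2)$-flexible. Consequently, $\chi_{flex}(G)=3$.
   Context: $P_n$ is the path on $n$ vertices. The Cartesian product $G\square H$ has vertex set $V(G)\times V(H)$, with $(u,v)$ adjacent to $(u',v')$ iff either $u=u'$ and $vv'\in E(H)$, or $v=v'$ and $uu'\in E(G)$. A list assignment $L$ assigns to each vertex $v$ a set $L(v)$ of colors; it is a $k$-assignment if $|L(v)|=k$ for all $v$. A proper $L$-coloring is a function $f$ on the vertex set with $f(v)\in L(v)$ and $f(u)\neq f(v)$ for adjacent $u,v$. A request of $L$ is a function $r$ with non-empty domain $D$ (a set of vertices) with $r(v)\in L(v)$ for $v\in D$. For $\epsilon\in(0,1]$, $(G,L,r)$ is $\epsilon$-satisfiable if some proper $L$-coloring $f$ has $f(v)=r(v)$ for at least $\epsilon|D|$ vertices $v\in D$. $G$ is $(k,\epsilon)$-flexible if $(G,L,r)$ is $\epsilon$-satisfiable for every $k$-assignment $L$ and every request $r$ of $L$. The Hall ratio is $\rho(G)=\max_H |V(H)|/\alpha(H)$ over nonempty subgraphs $H$ of $G$; the list flexibility number $\chi_{flex}(G)$ is the smallest $k$ such that $G$ is $(k,1/\rho(G))$-flexible. -}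

module Defs where

open import Data.Nat using (ℕ; zero; suc; _≤_; _<_; _≡ᵇ_)
open import Data.Bool using (Bool; true; false; _∧_)
open import Data.Fin using (Fin; toℕ)
open import Data.List using (List; length; cartesianProduct; allFin)
open import Data.List.Membership.Propositional using (_∈_)
open import Data.List.Relation.Unary.Unique.Propositional using (Unique)
open import Data.Product using (Σ; ∃; _×_; _,_)
open import Data.Sum using (_⊎_)
open import Data.Integer using (+_)
open import Data.Rational using (ℚ; _/_; _*_; 0ℚ; NonZero; 1/_)
import Data.Rational as ℚ
open import Relation.Binary.PropositionalEquality using (_≡_; _≢_)
open import Relation.Nullary using (¬_)

-- Finite graphs.  'vertices' lists every element of V exactly once
-- (true by construction for the graphs built below); it is used only
-- to count sizes of vertex subsets.

record Graph : Set₁ where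
  field
    V        : Set
    Adj      : V → V → Set
    vertices : List V
open Graph public

countTrue : {A : Set} → (A → Bool) → List A → ℕ
countTrue p List.[] = 0
countTrue p (x List.∷ xs) with p x
... | true  = suc (countTrue p xs)
... | false = countTrue p xs

size : (G : Graph) → (V G → Bool) → ℕ
size G S = countTrue S (vertices G)

Path : ℕ → Graph
Path n = record
  { V        = Fin n
  ; Adj      = λ i j → (suc (toℕ i) ≡ toℕ j) ⊎ (suc (toℕ j) ≡ toℕ i)
  ; vertices = allFin n
  }

_□_ : Graph → Graph → Graph
G □ H = record
  { V        = V G × V H
  ; Adj      = λ { (u , v) (u' , v') → (u ≡ u' × Adj H v v') ⊎ (v ≡ v' × Adj G u u') }
  ; vertices = cartesianProduct (vertices G) (vertices H)
  }

IsKAssignment : (G : Graph) → ℕ → (V G → List ℕ) → Set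
IsKAssignment G k L = ∀ v → length (L v) ≡ k × Unique (L v)

IsProperLColoring : (G : Graph) → (V G → List ℕ) → (V G → ℕ) → Set
IsProperLColoring G L f = (∀ v → f v ∈ L v) × (∀ u v → Adj G u v → f u ≢ f v)

-- a request of L: domain D (characteristic function, non-empty) and
-- values r(v) ∈ L(v) for v ∈ D (values of r outside D are irrelevant)
IsRequest : (G : Graph) → (V G → List ℕ) → (V G → Bool) → (V G → ℕ) → Set
IsRequest G L D r = (∃ λ v → D v ≡ true) × (∀ v → D v ≡ true → r v ∈ L v)

ℕtoℚ : ℕ → ℚ
ℕtoℚ n = + n / 1

Satisfiable : (G : Graph) → ℚ → (V G → List ℕ) → (V G → Bool) → (V G → ℕ) → Set
Satisfiable G ε L D r =
  Σ (V G → ℕ) λ f → IsProperLColoring G L f ×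
    (ε * ℕtoℚ (size G D) ℚ.≤ ℕtoℚ (size G (λ v → D v ∧ (f v ≡ᵇ r v))))

Flexible : Graph → ℕ → ℚ → Set
Flexible G k ε = ∀ (L : V G → List ℕ) → IsKAssignment G k L →
  ∀ (D : V G → Bool) (r : V G → ℕ) → IsRequest G L D r → Satisfiable G ε L D r

record Subgraph (G : Graph) : Set₁ where
  field
    S     : V G → Bool
    E     : V G → V G → Set
    E⊆Adj : ∀ u v → E u v → Adj G u v × S u ≡ true × S v ≡ true
open Subgraph public

NonemptySub : {G : Graph} → Subgraph G → Set
NonemptySub H = ∃ λ v → S H v ≡ true

IsIndependent : {G : Graph} → Subgraph G → (V G → Bool) → Set
IsIndependent H I = (∀ v → I v ≡ true → S H v ≡ true) ×
                    (∀ u v → I u ≡ true → I v ≡ true → ¬ E H u v)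

IsIndependenceNumber : (G : Graph) → Subgraph G → ℕ → Set
IsIndependenceNumber G H a =
  (Σ (V G → Bool) λ I → IsIndependent H I × size G I ≡ a) ×
  (∀ I → IsIndependent H I → size G I ≤ a)

-- the rational s / a (junk value 0 for a = 0, never used: α(H) ≥ 1 for nonempty H)
ratio : ℕ → ℕ → ℚ
ratio s zero    = 0ℚ
ratio s (suc a) = + s / suc a

IsHallRatio : Graph → ℚ → Set₁
IsHallRatio G ρ =
  (Σ (Subgraph G) λ H → NonemptySub H × Σ ℕ λ a →
      IsIndependenceNumber G H a × ρ ≡ ratio (size G (S H)) a) ×
  (∀ (H : Subgraph G) → NonemptySub H → ∀ a → IsIndependenceNumber G H a →
      ratio (size G (S H)) a ℚ.≤ ρ)

ListFlexNumberIs : Graph → ℕ → Set₁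
ListFlexNumberIs G k =
  Σ ℚ λ ρ → IsHallRatio G ρ × Σ (NonZero ρ) λ nz →
    1 ≤ k × Flexible G k (1/_ ρ {{nz}}) ×
    (∀ j → 1 ≤ j → j < k → ¬ Flexible G j (1/_ ρ {{nz}}))

-- It suffices to find two proper L-colourings f₁, f₂ such that every vertex receives its
-- request from at least one of them: then one of the two honours at least half of the requests.
-- Such a pair is built rung by rung along the ladder, keeping f₁ and f₂ different at every
-- vertex. At each new rung every vertex has lost at most one colour of its 3-list to its left
-- neighbour in each colouring, and a finite case analysis (up to the symmetries exchanging the
-- colourings and the rows) places both requests of the rung.
-- For χ_flex = 3: the ladder is bipartite and has an edge, so ρ = 2; it is not 1-flexible
-- because equal 1-lists on an edge admit no colouring, and not (2, 1/2)-flexible because suitable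
-- 2-lists on a 4-cycle forbid the single request at one corner.

module Submission where

open import Algebra.Properties.CommutativeSemigroup using (interchange)
open import Data.Bool using (Bool; true; false; _∧_; not)
open import Data.Bool.Properties using (T-≡; not-¬; not-injective)
open import Data.Fin using (Fin; zero; suc; toℕ; fromℕ<)
open import Data.Fin.Properties using (fromℕ<-toℕ; toℕ<n)
open import Data.Integer using (+_; +≤+)
import Data.Integer as ℤ
open import Data.Integer.Properties using (pos-*; *-identityˡ)
open import Data.List using (List; []; _∷_; _++_; length; map; tabulate)
open import Data.List.Membership.Propositional using (_∈_)
open import Data.List.Relation.Unary.All using (All; []; _∷_)
open import Data.List.Relation.Unary.All.Properties using (map⁺; tabulate⁺)
open import Data.List.Relation.Unary.AllPairs using ([]; _∷_)
open import Data.List.Relation.Unary.Any using (here; there)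
open import Data.List.Relation.Unary.Unique.Propositional using (Unique)
open import Data.Nat using (ℕ; zero; suc; _+_; _≤_; _<_; _<?_; _≟_; _≡ᵇ_; z≤n; s≤s)
import Data.Nat as ℕ
open import Data.Nat.Properties
  using (≡⇒≡ᵇ; ≡ᵇ⇒≡; ≤-trans; ≤-total; +-mono-≤; +-monoˡ-≤; +-monoʳ-≤; +-identityʳ; *-identityʳ;
         *-comm; +-commutativeSemigroup; module ≤-Reasoning)
open import Data.Product using (Σ; ∃-syntax; _×_; _,_; proj₁; proj₂)
open import Data.Rational using (_/_; ½; toℚᵘ)
import Data.Rational as ℚ
open import Data.Rational.Properties using (toℚᵘ-cancel-≤; toℚᵘ-fromℚᵘ; toℚᵘ-homo-*)
open import Data.Rational.Unnormalised using (mkℚᵘ; *≤*; *≡*)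
import Data.Rational.Unnormalised as ℚᵘ
import Data.Rational.Unnormalised.Properties as ℚᵘ
open import Data.Sum using (_⊎_; inj₁; inj₂; swap)
import Data.Sum as Sum
open import Function using (_∘_; Equivalence)
open import Relation.Nullary using (¬_; yes; no; contradiction)
open import Relation.Binary.PropositionalEquality
  using (_≡_; _≢_; refl; sym; trans; subst; subst₂; cong; cong₂; ≢-sym; module ≡-Reasoning)

open import Defs

-- Counting vertex subsets

indicator : Bool → ℕ
indicator true  = 1
indicator false = 0

countTrue-∷ : ∀ {A : Set} (p : A → Bool) x xs → countTrue p (x ∷ xs) ≡ indicator (p x) + countTrue p xs
countTrue-∷ p x xs with p x
... | true  = refl
... | false = refl

countTrue-skip : ∀ {A : Set} (p : A → Bool) {xs} ys → All (λ x → p x ≡ false) xs →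
  countTrue p (xs ++ ys) ≡ countTrue p ys
countTrue-skip p ys [] = refl
countTrue-skip p ys (px≡false ∷ pxs≡false) rewrite px≡false = countTrue-skip p ys pxs≡false

indicator-cover : ∀ {a b c} → (a ≡ true → b ≡ true ⊎ c ≡ true) → indicator a ≤ indicator b + indicator c
indicator-cover {false}                _ = z≤n
indicator-cover {true} {true}          _ = s≤s z≤n
indicator-cover {true} {false} {true}  _ = s≤s z≤n
indicator-cover {true} {false} {false} a⇒b∨c with a⇒b∨c refl
... | inj₁ ()
... | inj₂ ()

countTrue-cover : ∀ {A : Set} (p q s : A → Bool) → (∀ x → p x ≡ true → q x ≡ true ⊎ s x ≡ true) →
  ∀ xs → countTrue p xs ≤ countTrue q xs + countTrue s xs
countTrue-cover p q s cover []       = z≤n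
countTrue-cover p q s cover (x ∷ xs) = begin
  countTrue p (x ∷ xs)                                                 ≡⟨ countTrue-∷ p x xs ⟩
  indicator (p x) + countTrue p xs
    ≤⟨ +-mono-≤ (indicator-cover (cover x)) (countTrue-cover p q s cover xs) ⟩
  (indicator (q x) + indicator (s x)) + (countTrue q xs + countTrue s xs)
    ≡⟨ interchange +-commutativeSemigroup (indicator (q x)) (indicator (s x)) (countTrue q xs) (countTrue s xs) ⟩
  (indicator (q x) + countTrue q xs) + (indicator (s x) + countTrue s xs)
    ≡⟨ cong₂ _+_ (countTrue-∷ q x xs) (countTrue-∷ s x xs) ⟨
  countTrue q (x ∷ xs) + countTrue s (x ∷ xs)                          ∎
  where open ≤-Reasoning

∧-true : ∀ a {b} → (a ∧ b) ≡ true → a ≡ true × b ≡ true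
∧-true true b≡true = refl , b≡true

≢⇒≡ᵇ-false : ∀ {m n} → m ≢ n → (m ≡ᵇ n) ≡ false
≢⇒≡ᵇ-false {m} {n} m≢n with m ≡ᵇ n in m≡ᵇn
... | false = refl
... | true  = contradiction (≡ᵇ⇒≡ m n (Equivalence.from T-≡ m≡ᵇn)) m≢n

toℚᵘ-/ : ∀ a b → toℚᵘ (+ a / suc b) ℚᵘ.≃ mkℚᵘ (+ a) b
toℚᵘ-/ a b = toℚᵘ-fromℚᵘ (mkℚᵘ (+ a) b)

mkℚᵘ-mono-≤ : ∀ {a b c d} → a ℕ.* suc d ≤ c ℕ.* suc b → mkℚᵘ (+ a) b ℚᵘ.≤ mkℚᵘ (+ c) d
mkℚᵘ-mono-≤ {a} {b} {c} {d} ad≤cb = *≤* (subst₂ ℤ._≤_ (pos-* a (suc d)) (pos-* c (suc b)) (+≤+ ad≤cb))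

/-mono-≤ : ∀ {a b c d} → a ℕ.* suc d ≤ c ℕ.* suc b → + a / suc b ℚ.≤ + c / suc d
/-mono-≤ {a} {b} {c} {d} ad≤cb = toℚᵘ-cancel-≤ (begin
  toℚᵘ (+ a / suc b)  ≃⟨ toℚᵘ-/ a b ⟩
  mkℚᵘ (+ a) b        ≤⟨ mkℚᵘ-mono-≤ ad≤cb ⟩
  mkℚᵘ (+ c) d        ≃⟨ toℚᵘ-/ c d ⟨
  toℚᵘ (+ c / suc d)  ∎)
  where open ℚᵘ.≤-Reasoning

½*-≤ : ∀ {d c} → d ≤ c + c → ½ ℚ.* ℕtoℚ d ℚ.≤ ℕtoℚ c
½*-≤ {d} {c} d≤c+c = toℚᵘ-cancel-≤ (begin
  toℚᵘ (½ ℚ.* ℕtoℚ d)                ≃⟨ toℚᵘ-homo-* ½ (ℕtoℚ d) ⟩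
  mkℚᵘ (+ 1) 1 ℚᵘ.* toℚᵘ (ℕtoℚ d)    ≃⟨ ℚᵘ.*-congˡ {mkℚᵘ (+ 1) 1} (toℚᵘ-/ d 0) ⟩
  mkℚᵘ (+ 1) 1 ℚᵘ.* mkℚᵘ (+ d) 0     ≃⟨ *≡* (cong (ℤ._* + 2) (*-identityˡ (+ d))) ⟩
  mkℚᵘ (+ d) 1                       ≤⟨ mkℚᵘ-mono-≤ (subst₂ _≤_ (sym (*-identityʳ d)) c+c≡c*2 d≤c+c) ⟩
  mkℚᵘ (+ c) 0                       ≃⟨ toℚᵘ-/ c 0 ⟨
  toℚᵘ (ℕtoℚ c)                      ∎)
  where
  open ℚᵘ.≤-Reasoning
  c+c≡c*2 : c + c ≡ c ℕ.* 2
  c+c≡c*2 = trans (cong (λ t → c + t) (sym (+-identityʳ c))) (*-comm 2 c)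

ratio-≤-2 : ∀ {s} a → s ≤ a + a → ratio s a ℚ.≤ + 2 / 1
ratio-≤-2     zero    _     = /-mono-≤ {0} {0} {2} {0} z≤n
ratio-≤-2 {s} (suc a) s≤a+a =
  /-mono-≤ {s} {a} {2} {0} (subst₂ _≤_ (sym (*-identityʳ s)) a+a≡2a s≤a+a)
  where
  a+a≡2a : suc a + suc a ≡ 2 ℕ.* suc a
  a+a≡2a = cong (λ t → suc a + t) (sym (+-identityʳ (suc a)))

½*1≰0 : ¬ (½ ℚ.* ℕtoℚ 1 ℚ.≤ ℕtoℚ 0)
½*1≰0 (ℚ.*≤* (+≤+ ()))

satisfiable-from-cover : ∀ G (L : V G → List ℕ) D r (f g : V G → ℕ) →
  IsProperLColoring G L f → IsProperLColoring G L g → (∀ v → D v ≡ true → f v ≡ r v ⊎ g v ≡ r v) →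
  Satisfiable G ½ L D r
satisfiable-from-cover G L D r f g f-proper g-proper cover =
  better (≤-total (size G (hits f)) (size G (hits g)))
  where
  hits : (V G → ℕ) → V G → Bool
  hits h v = D v ∧ (h v ≡ᵇ r v)

  hit : ∀ h v → D v ≡ true → h v ≡ r v → hits h v ≡ true
  hit h v Dv≡true hv≡rv rewrite Dv≡true | hv≡rv = Equivalence.to T-≡ (≡⇒≡ᵇ (r v) (r v) refl)

  bound : size G D ≤ size G (hits f) + size G (hits g)
  bound = countTrue-cover D (hits f) (hits g)
    (λ v Dv≡true → Sum.map (hit f v Dv≡true) (hit g v Dv≡true) (cover v Dv≡true)) (vertices G)

  better : size G (hits f) ≤ size G (hits g) ⊎ size G (hits g) ≤ size G (hits f) → Satisfiable G ½ L D r
  better (inj₁ f≤g) =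
    g , g-proper , ½*-≤ {c = size G (hits g)} (≤-trans bound (+-monoˡ-≤ (size G (hits g)) f≤g))
  better (inj₂ g≤f) =
    f , f-proper , ½*-≤ {c = size G (hits f)} (≤-trans bound (+-monoʳ-≤ (size G (hits f)) g≤f))

bipartite-ratio≤2 : ∀ G (c : V G → Bool) → (∀ u v → Adj G u v → c u ≢ c v) →
  ∀ (H : Subgraph G) a → IsIndependenceNumber G H a → ratio (size G (S H)) a ℚ.≤ + 2 / 1
bipartite-ratio≤2 G c c-proper H a (_ , α-max) = ratio-≤-2 a (begin
  size G (S H)
    ≤⟨ countTrue-cover (S H) _ _ split (vertices G) ⟩
  size G (λ v → S H v ∧ c v) + size G (λ v → S H v ∧ not (c v))
    ≤⟨ +-mono-≤ (α-max _ (class-independent c same-true)) (α-max _ (class-independent (not ∘ c) same-false)) ⟩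
  a + a ∎)
  where
  open ≤-Reasoning

  class-independent : (P : V G → Bool) → (∀ u v → P u ≡ true → P v ≡ true → c u ≡ c v) →
    IsIndependent H (λ v → S H v ∧ P v)
  class-independent P same =
    (λ v → proj₁ ∘ ∧-true (S H v)) ,
    λ u v Iu Iv Euv → c-proper u v (proj₁ (E⊆Adj H u v Euv))
                        (same u v (proj₂ (∧-true (S H u) Iu)) (proj₂ (∧-true (S H v) Iv)))

  same-true : ∀ u v → c u ≡ true → c v ≡ true → c u ≡ c v
  same-true u v cu cv = trans cu (sym cv)

  same-false : ∀ u v → not (c u) ≡ true → not (c v) ≡ true → c u ≡ c v
  same-false u v cu cv = not-injective (trans cu (sym cv))

  split : ∀ v → S H v ≡ true → (S H v ∧ c v) ≡ true ⊎ (S H v ∧ not (c v)) ≡ true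
  split v Sv≡true rewrite Sv≡true with c v
  ... | true  = inj₁ refl
  ... | false = inj₂ refl

-- Extending two disjoint colourings by one rung

record Pair : Set where
  constructor pair
  field
    fst snd : ℕ
    fst≢snd : fst ≢ snd
open Pair

data _∈₂_ (x : ℕ) (P : Pair) : Set where
  ≡fst : x ≡ fst P → x ∈₂ P
  ≡snd : x ≡ snd P → x ∈₂ P

∈∉⇒≢ : ∀ {x y P} → x ∈₂ P → ¬ y ∈₂ P → x ≢ y
∈∉⇒≢ x∈P y∉P refl = y∉P x∈P

avoid : (P : Pair) (s : ℕ) → ∃[ x ] x ∈₂ P × x ≢ s
avoid (pair a b a≢b) s with a ≟ s
... | no a≢s   = a , ≡fst refl , a≢s
... | yes refl = b , ≡snd refl , ≢-sym a≢b

avoid-both : (P : Pair) (s t : ℕ) →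
  (∃[ x ] x ∈₂ P × x ≢ s × x ≢ t) ⊎ (s ≢ t × s ∈₂ P × t ∈₂ P)
avoid-both P s t with avoid P s
... | x , x∈P , x≢s with x ≟ t
...   | no x≢t = inj₁ (x , x∈P , x≢s , x≢t)
...   | yes refl with avoid P x
...     | y , y∈P , y≢x with y ≟ s
...       | no y≢s   = inj₁ (y , y∈P , y≢s , y≢x)
...       | yes refl = inj₂ (y≢x , y∈P , x∈P)

-- A list of three colours, split into a distinguished colour (the request) and the other two.
record Triple : Set where
  constructor triple
  field
    point      : ℕ
    rest       : Pair
    point∉rest : ¬ point ∈₂ rest
open Triple

data _∈₃_ (x : ℕ) (T : Triple) : Set where
  ≡point : x ≡ point T → x ∈₃ T
  ∈rest  : x ∈₂ rest T → x ∈₃ T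

-- Two proper colourings of a rung: the k-th colours the top vertex xₖ and the bottom vertex yₖ,
-- and the two colourings differ at both vertices.
record Column : Set where
  constructor column
  field
    x₁ x₂ y₁ y₂ : ℕ
    x₁≢y₁ : x₁ ≢ y₁
    x₂≢y₂ : x₂ ≢ y₂
    x₁≢x₂ : x₁ ≢ x₂
    y₁≢y₂ : y₁ ≢ y₂

-- The next rung after one coloured (a₁, b₁) and (a₂, b₂), with lists U at the top and W at the
-- bottom, honouring both requests.
record Extension (a₁ a₂ b₁ b₂ : ℕ) (U W : Triple) : Set where
  field
    x₁ x₂ y₁ y₂ : ℕ
    x₁∈U : x₁ ∈₃ U
    x₂∈U : x₂ ∈₃ U
    y₁∈W : y₁ ∈₃ W
    y₂∈W : y₂ ∈₃ W
    x₁≢a₁ : x₁ ≢ a₁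
    x₂≢a₂ : x₂ ≢ a₂
    y₁≢b₁ : y₁ ≢ b₁
    y₂≢b₂ : y₂ ≢ b₂
    x₁≢y₁ : x₁ ≢ y₁
    x₂≢y₂ : x₂ ≢ y₂
    x₁≢x₂ : x₁ ≢ x₂
    y₁≢y₂ : y₁ ≢ y₂
    U-served : point U ≡ x₁ ⊎ point U ≡ x₂
    W-served : point W ≡ y₁ ⊎ point W ≡ y₂

  toColumn : Column
  toColumn = column x₁ x₂ y₁ y₂ x₁≢y₁ x₂≢y₂ x₁≢x₂ y₁≢y₂

Extension-swap : ∀ {a₁ a₂ b₁ b₂ U W} → Extension a₂ a₁ b₂ b₁ U W → Extension a₁ a₂ b₁ b₂ U W
Extension-swap e = record
  { x₁ = x₂ ; x₂ = x₁ ; y₁ = y₂ ; y₂ = y₁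
  ; x₁∈U = x₂∈U ; x₂∈U = x₁∈U ; y₁∈W = y₂∈W ; y₂∈W = y₁∈W
  ; x₁≢a₁ = x₂≢a₂ ; x₂≢a₂ = x₁≢a₁ ; y₁≢b₁ = y₂≢b₂ ; y₂≢b₂ = y₁≢b₁
  ; x₁≢y₁ = x₂≢y₂ ; x₂≢y₂ = x₁≢y₁ ; x₁≢x₂ = ≢-sym x₁≢x₂ ; y₁≢y₂ = ≢-sym y₁≢y₂
  ; U-served = swap U-served ; W-served = swap W-served }
  where open Extension e

Extension-mirror : ∀ {a₁ a₂ b₁ b₂ U W} → Extension b₂ b₁ a₂ a₁ W U → Extension a₁ a₂ b₁ b₂ U W
Extension-mirror e = record
  { x₁ = y₂ ; x₂ = y₁ ; y₁ = x₂ ; y₂ = x₁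
  ; x₁∈U = y₂∈W ; x₂∈U = y₁∈W ; y₁∈W = x₂∈U ; y₂∈W = x₁∈U
  ; x₁≢a₁ = y₂≢b₂ ; x₂≢a₂ = y₁≢b₁ ; y₁≢b₁ = x₂≢a₂ ; y₂≢b₂ = x₁≢a₁
  ; x₁≢y₁ = ≢-sym x₂≢y₂ ; x₂≢y₂ = ≢-sym x₁≢y₁ ; x₁≢x₂ = ≢-sym y₁≢y₂ ; y₁≢y₂ = ≢-sym x₁≢x₂
  ; U-served = swap W-served ; W-served = swap U-served }
  where open Extension e

extend-onto-b₂ : ∀ {a₁ a₂ b₁} (U W : Triple) → point U ≢ a₁ → a₂ ≢ point W → b₁ ≢ point W →
  Extension a₁ a₂ b₁ (point W) U W
extend-onto-b₂ {a₁} {a₂} (triple ru P ru∉P) (triple rw Q rw∉Q) ru≢a₁ a₂≢rw b₁≢rw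
  with ru ≟ rw | avoid P a₁ | avoid P a₂
... | yes refl | x , x∈P , x≢a₁ | _ = record
  { x₁ = x ; x₂ = ru ; y₁ = ru ; y₂ = fst Q
  ; x₁∈U = ∈rest x∈P ; x₂∈U = ≡point refl ; y₁∈W = ≡point refl ; y₂∈W = ∈rest (≡fst refl)
  ; x₁≢a₁ = x≢a₁ ; x₂≢a₂ = ≢-sym a₂≢rw ; y₁≢b₁ = ≢-sym b₁≢rw ; y₂≢b₂ = q≢ru
  ; x₁≢y₁ = x≢ru ; x₂≢y₂ = ≢-sym q≢ru ; x₁≢x₂ = x≢ru ; y₁≢y₂ = ≢-sym q≢ru
  ; U-served = inj₂ refl ; W-served = inj₁ refl }
  where
  x≢ru : x ≢ ru
  x≢ru = ∈∉⇒≢ x∈P ru∉P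
  q≢ru : fst Q ≢ ru
  q≢ru = ∈∉⇒≢ (≡fst refl) rw∉Q
... | no ru≢rw | _ | x , x∈P , x≢a₂ with avoid Q x
...     | y , y∈Q , y≢x = record
  { x₁ = ru ; x₂ = x ; y₁ = rw ; y₂ = y
  ; x₁∈U = ≡point refl ; x₂∈U = ∈rest x∈P ; y₁∈W = ≡point refl ; y₂∈W = ∈rest y∈Q
  ; x₁≢a₁ = ru≢a₁ ; x₂≢a₂ = x≢a₂ ; y₁≢b₁ = ≢-sym b₁≢rw ; y₂≢b₂ = ∈∉⇒≢ y∈Q rw∉Q
  ; x₁≢y₁ = ru≢rw ; x₂≢y₂ = ≢-sym y≢x
  ; x₁≢x₂ = ≢-sym (∈∉⇒≢ x∈P ru∉P) ; y₁≢y₂ = ≢-sym (∈∉⇒≢ y∈Q rw∉Q)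
  ; U-served = inj₁ refl ; W-served = inj₁ refl }

-- Here the placement x₁ = point U, y₂ = point W can fail, since rest U = {a₂, point W}.
extend-blocked : ∀ {a₁ a₂ b₁ b₂} (U W : Triple) → a₁ ≢ a₂ → point U ≢ a₁ → point W ≢ b₂ →
  a₂ ≢ point W → a₂ ∈₂ rest U → point W ∈₂ rest U → Extension a₁ a₂ b₁ b₂ U W
extend-blocked {a₂ = a₂} {b₁} {b₂} (triple ru P ru∉P) (triple rw Q rw∉Q)
  a₁≢a₂ ru≢a₁ rw≢b₂ a₂≢rw a₂∈P rw∈P with rw ≟ b₁ | avoid Q b₂ | avoid Q a₂
... | no rw≢b₁ | y , y∈Q , y≢b₂ | _ = record
  { x₁ = ru ; x₂ = rw ; y₁ = rw ; y₂ = y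
  ; x₁∈U = ≡point refl ; x₂∈U = ∈rest rw∈P ; y₁∈W = ≡point refl ; y₂∈W = ∈rest y∈Q
  ; x₁≢a₁ = ru≢a₁ ; x₂≢a₂ = ≢-sym a₂≢rw ; y₁≢b₁ = rw≢b₁ ; y₂≢b₂ = y≢b₂
  ; x₁≢y₁ = ru≢rw ; x₂≢y₂ = rw≢y ; x₁≢x₂ = ru≢rw ; y₁≢y₂ = rw≢y
  ; U-served = inj₁ refl ; W-served = inj₁ refl }
  where
  ru≢rw : ru ≢ rw
  ru≢rw = ≢-sym (∈∉⇒≢ rw∈P ru∉P)
  rw≢y : rw ≢ y
  rw≢y = ≢-sym (∈∉⇒≢ y∈Q rw∉Q)
... | yes refl | _ | y , y∈Q , y≢a₂ = record
  { x₁ = a₂ ; x₂ = ru ; y₁ = y ; y₂ = rw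
  ; x₁∈U = ∈rest a₂∈P ; x₂∈U = ≡point refl ; y₁∈W = ∈rest y∈Q ; y₂∈W = ≡point refl
  ; x₁≢a₁ = ≢-sym a₁≢a₂ ; x₂≢a₂ = ≢-sym a₂≢ru ; y₁≢b₁ = ∈∉⇒≢ y∈Q rw∉Q ; y₂≢b₂ = rw≢b₂
  ; x₁≢y₁ = ≢-sym y≢a₂ ; x₂≢y₂ = ≢-sym (∈∉⇒≢ rw∈P ru∉P)
  ; x₁≢x₂ = a₂≢ru ; y₁≢y₂ = ∈∉⇒≢ y∈Q rw∉Q
  ; U-served = inj₂ refl ; W-served = inj₂ refl }
  where
  a₂≢ru : a₂ ≢ ru
  a₂≢ru = ∈∉⇒≢ a₂∈P ru∉P

extend-diagonal : ∀ {a₁ a₂ b₁ b₂} (U W : Triple) → a₁ ≢ a₂ → b₁ ≢ b₂ →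
  point U ≢ a₁ → point W ≢ b₂ → Extension a₁ a₂ b₁ b₂ U W
extend-diagonal {a₂ = a₂} {b₁} U@(triple ru P ru∉P) W@(triple rw Q rw∉Q) a₁≢a₂ b₁≢b₂ ru≢a₁ rw≢b₂
  with avoid-both P a₂ rw | avoid-both Q b₁ ru
... | inj₂ (a₂≢rw , a₂∈P , rw∈P) | _ =
  extend-blocked U W a₁≢a₂ ru≢a₁ rw≢b₂ a₂≢rw a₂∈P rw∈P
... | inj₁ _ | inj₂ (b₁≢ru , b₁∈Q , ru∈Q) =
  Extension-mirror (extend-blocked W U (≢-sym b₁≢b₂) rw≢b₂ ru≢a₁ b₁≢ru b₁∈Q ru∈Q)
... | inj₁ (x , x∈P , x≢a₂ , x≢rw) | inj₁ (y , y∈Q , y≢b₁ , y≢ru) = record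
  { x₁ = ru ; x₂ = x ; y₁ = y ; y₂ = rw
  ; x₁∈U = ≡point refl ; x₂∈U = ∈rest x∈P ; y₁∈W = ∈rest y∈Q ; y₂∈W = ≡point refl
  ; x₁≢a₁ = ru≢a₁ ; x₂≢a₂ = x≢a₂ ; y₁≢b₁ = y≢b₁ ; y₂≢b₂ = rw≢b₂
  ; x₁≢y₁ = ≢-sym y≢ru ; x₂≢y₂ = x≢rw
  ; x₁≢x₂ = ≢-sym (∈∉⇒≢ x∈P ru∉P) ; y₁≢y₂ = ∈∉⇒≢ y∈Q rw∉Q
  ; U-served = inj₁ refl ; W-served = inj₂ refl }

extend-avoiding : ∀ {a₁ a₂ b₁ b₂} (U W : Triple) → a₁ ≢ a₂ → b₁ ≢ b₂ → a₂ ≢ b₂ →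
  point U ≢ a₁ → Extension a₁ a₂ b₁ b₂ U W
extend-avoiding {b₂ = b₂} U W a₁≢a₂ b₁≢b₂ a₂≢b₂ ru≢a₁ with point W ≟ b₂
... | yes refl  = extend-onto-b₂ U W ru≢a₁ a₂≢b₂ b₁≢b₂
... | no rw≢b₂ = extend-diagonal U W a₁≢a₂ b₁≢b₂ ru≢a₁ rw≢b₂

extend : (c : Column) (U W : Triple) →
  Extension (Column.x₁ c) (Column.x₂ c) (Column.y₁ c) (Column.y₂ c) U W
extend (column a₁ a₂ b₁ b₂ a₁≢b₁ a₂≢b₂ a₁≢a₂ b₁≢b₂) U W with point U ≟ a₁
... | no ru≢a₁ = extend-avoiding U W a₁≢a₂ b₁≢b₂ a₂≢b₂ ru≢a₁
... | yes refl = Extension-swap (extend-avoiding U W (≢-sym a₁≢a₂) (≢-sym b₁≢b₂) a₁≢b₁ a₁≢a₂)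

module InfiniteLadder (T : Fin 2 → ℕ → Triple) where

  -- state i carries the colours of column i - 1; state 0 is a fictitious column left of column 0.
  state : ℕ → Column
  extension : (i : ℕ) → let open Column (state i) in
    Extension x₁ x₂ y₁ y₂ (T zero i) (T (suc zero) i)
  state zero    = column 0 1 1 0 (λ ()) (λ ()) (λ ()) (λ ())
  state (suc i) = Extension.toColumn (extension i)
  extension i = extend (state i) (T zero i) (T (suc zero) i)

  -- colour k j i: the colour of row j, column i in the k-th colouring.
  colour : Fin 2 → Fin 2 → ℕ → ℕ
  colour zero       zero       i = Extension.x₁ (extension i)
  colour zero       (suc zero) i = Extension.y₁ (extension i)
  colour (suc zero) zero       i = Extension.x₂ (extension i)
  colour (suc zero) (suc zero) i = Extension.y₂ (extension i)

  colour-∈ : ∀ k j i → colour k j i ∈₃ T j i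
  colour-∈ zero       zero       i = Extension.x₁∈U (extension i)
  colour-∈ zero       (suc zero) i = Extension.y₁∈W (extension i)
  colour-∈ (suc zero) zero       i = Extension.x₂∈U (extension i)
  colour-∈ (suc zero) (suc zero) i = Extension.y₂∈W (extension i)

  colour-row : ∀ k j i → colour k j (suc i) ≢ colour k j i
  colour-row zero       zero       i = Extension.x₁≢a₁ (extension (suc i))
  colour-row zero       (suc zero) i = Extension.y₁≢b₁ (extension (suc i))
  colour-row (suc zero) zero       i = Extension.x₂≢a₂ (extension (suc i))
  colour-row (suc zero) (suc zero) i = Extension.y₂≢b₂ (extension (suc i))

  colour-rung : ∀ k i → colour k zero i ≢ colour k (suc zero) i
  colour-rung zero       i = Extension.x₁≢y₁ (extension i)
  colour-rung (suc zero) i = Extension.x₂≢y₂ (extension i)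

  colour-serves : ∀ j i → point (T j i) ≡ colour zero j i ⊎ point (T j i) ≡ colour (suc zero) j i
  colour-serves zero       i = Extension.U-served (extension i)
  colour-serves (suc zero) i = Extension.W-served (extension i)

-- Two colourings of the ladder P₂ □ Pₙ

Ladder : ℕ → Graph
Ladder n = Path 2 □ Path n

restrict : ∀ {A : Set} {n} → (Fin 2 → ℕ → A) → V (Ladder n) → A
restrict g (j , k) = g j (toℕ k)

restrict-proper : ∀ {A : Set} {n} (g : Fin 2 → ℕ → A) →
  (∀ j i → g j (suc i) ≢ g j i) → (∀ i → g zero i ≢ g (suc zero) i) →
  ∀ u v → Adj (Ladder n) u v → restrict g u ≢ restrict g v
restrict-proper g row rung (j , k) (.j , k') (inj₁ (refl , inj₁ k+1≡k'))
  rewrite sym k+1≡k' = ≢-sym (row j (toℕ k))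
restrict-proper g row rung (j , k) (.j , k') (inj₁ (refl , inj₂ k'+1≡k))
  rewrite sym k'+1≡k = row j (toℕ k')
restrict-proper g row rung (zero , k) (suc zero , .k) (inj₂ (refl , _)) = rung (toℕ k)
restrict-proper g row rung (suc zero , k) (zero , .k) (inj₂ (refl , _)) = ≢-sym (rung (toℕ k))
restrict-proper g row rung (zero , k) (zero , .k) (inj₂ (refl , inj₁ ()))
restrict-proper g row rung (zero , k) (zero , .k) (inj₂ (refl , inj₂ ()))
restrict-proper g row rung (suc zero , k) (suc zero , .k) (inj₂ (refl , inj₁ ()))
restrict-proper g row rung (suc zero , k) (suc zero , .k) (inj₂ (refl , inj₂ ()))

fromFin : ∀ {A : Set} n → A → (Fin n → A) → ℕ → A
fromFin n a₀ g i with i <? n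
... | yes i<n = g (fromℕ< i<n)
... | no  _   = a₀

fromFin-toℕ : ∀ {A : Set} n (a₀ : A) g (k : Fin n) → fromFin n a₀ g (toℕ k) ≡ g k
fromFin-toℕ n a₀ g k with toℕ k <? n
... | yes k<n = cong g (fromℕ<-toℕ k k<n)
... | no  k≮n = contradiction (toℕ<n k) k≮n

distinct₃ : ∀ {a b c : ℕ} → Unique (a ∷ b ∷ c ∷ []) → a ≢ b × a ≢ c × b ≢ c
distinct₃ ((a≢b ∷ a≢c ∷ []) ∷ (b≢c ∷ []) ∷ [] ∷ []) = a≢b , a≢c , b≢c

∉pair : ∀ {a b c} {b≢c : b ≢ c} → a ≢ b → a ≢ c → ¬ a ∈₂ pair b c b≢c
∉pair a≢b a≢c (≡fst a≡b) = a≢b a≡b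
∉pair a≢b a≢c (≡snd a≡c) = a≢c a≡c

toTriple : (l : List ℕ) → length l ≡ 3 → Unique l → ∀ {x} → x ∈ l → Triple
toTriple (a ∷ b ∷ c ∷ []) refl u (here refl) =
  let a≢b , a≢c , b≢c = distinct₃ u in triple a (pair b c b≢c) (∉pair a≢b a≢c)
toTriple (a ∷ b ∷ c ∷ []) refl u (there (here refl)) =
  let a≢b , a≢c , b≢c = distinct₃ u in triple b (pair a c a≢c) (∉pair (≢-sym a≢b) b≢c)
toTriple (a ∷ b ∷ c ∷ []) refl u (there (there (here refl))) =
  let a≢b , a≢c , b≢c = distinct₃ u in triple c (pair a b a≢b) (∉pair (≢-sym a≢c) (≢-sym b≢c))

point-toTriple : ∀ l l≡3 u {x} (x∈l : x ∈ l) → point (toTriple l l≡3 u x∈l) ≡ x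
point-toTriple (a ∷ b ∷ c ∷ []) refl u (here refl)                 = refl
point-toTriple (a ∷ b ∷ c ∷ []) refl u (there (here refl))         = refl
point-toTriple (a ∷ b ∷ c ∷ []) refl u (there (there (here refl))) = refl

∈₃-⊆ : ∀ {T l y} → point T ∈ l → fst (rest T) ∈ l → snd (rest T) ∈ l → y ∈₃ T → y ∈ l
∈₃-⊆ p∈l _ _ (≡point refl)       = p∈l
∈₃-⊆ _ f∈l _ (∈rest (≡fst refl)) = f∈l
∈₃-⊆ _ _ s∈l (∈rest (≡snd refl)) = s∈l

toTriple-⊆ : ∀ l l≡3 u {x} (x∈l : x ∈ l) {y} → y ∈₃ toTriple l l≡3 u x∈l → y ∈ l
toTriple-⊆ (a ∷ b ∷ c ∷ []) refl u (here refl) =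
  ∈₃-⊆ (here refl) (there (here refl)) (there (there (here refl)))
toTriple-⊆ (a ∷ b ∷ c ∷ []) refl u (there (here refl)) =
  ∈₃-⊆ (there (here refl)) (here refl) (there (there (here refl)))
toTriple-⊆ (a ∷ b ∷ c ∷ []) refl u (there (there (here refl))) =
  ∈₃-⊆ (there (there (here refl))) (here refl) (there (here refl))

ladder-two-colourings : ∀ n (L : V (Ladder n) → List ℕ) → IsKAssignment (Ladder n) 3 L →
  (r : V (Ladder n) → ℕ) → (∀ v → r v ∈ L v) →
  Σ (V (Ladder n) → ℕ) λ f → Σ (V (Ladder n) → ℕ) λ g →
    IsProperLColoring (Ladder n) L f × IsProperLColoring (Ladder n) L g × (∀ v → f v ≡ r v ⊎ g v ≡ r v)
ladder-two-colourings n L K r r∈L = f zero , f (suc zero) , proper zero , proper (suc zero) , covers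
  where
  vertexTriple : V (Ladder n) → Triple
  vertexTriple v = toTriple (L v) (proj₁ (K v)) (proj₂ (K v)) (r∈L v)

  T : Fin 2 → ℕ → Triple
  T j = fromFin n (triple 0 (pair 1 2 (λ ())) (∉pair (λ ()) (λ ()))) (λ k → vertexTriple (j , k))

  T-vertex : ∀ j k → T j (toℕ k) ≡ vertexTriple (j , k)
  T-vertex j k = fromFin-toℕ n _ (λ k → vertexTriple (j , k)) k

  open InfiniteLadder T

  f : Fin 2 → V (Ladder n) → ℕ
  f k = restrict (colour k)

  proper : ∀ k → IsProperLColoring (Ladder n) L (f k)
  proper k = f∈L , restrict-proper (colour k) (colour-row k) (colour-rung k)
    where
    f∈L : ∀ v → f k v ∈ L v
    f∈L (j , m) = toTriple-⊆ (L (j , m)) _ _ (r∈L (j , m))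
      (subst (colour k j (toℕ m) ∈₃_) (T-vertex j m) (colour-∈ k j (toℕ m)))

  point-T : ∀ j m → point (T j (toℕ m)) ≡ r (j , m)
  point-T j m = trans (cong point (T-vertex j m)) (point-toTriple (L (j , m)) _ _ (r∈L (j , m)))

  covers : ∀ v → f zero v ≡ r v ⊎ f (suc zero) v ≡ r v
  covers (j , m) with colour-serves j (toℕ m)
  ... | inj₁ served = inj₁ (trans (sym served) (point-T j m))
  ... | inj₂ served = inj₂ (trans (sym served) (point-T j m))

fillRequest : (l : List ℕ) → length l ≡ 3 → (b : Bool) (x : ℕ) → (b ≡ true → x ∈ l) →
  ∃[ y ] y ∈ l × (b ≡ true → y ≡ x)
fillRequest l       _  true  x x∈l = x , x∈l refl , λ _ → refl
fillRequest (y ∷ _) _  false _ _   = y , here refl , λ ()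
fillRequest []      () false _ _

ladder-flexible : ∀ n → Flexible (Ladder n) 3 ½
ladder-flexible n L K D r (_ , r∈L) =
  let f , g , f-proper , g-proper , covers = ladder-two-colourings n L K r′ (proj₁ ∘ proj₂ ∘ filled)
  in satisfiable-from-cover (Ladder n) L D r f g f-proper g-proper
       λ v Dv≡true → Sum.map (λ fv≡r′v → trans fv≡r′v (r′≡r v Dv≡true))
                             (λ gv≡r′v → trans gv≡r′v (r′≡r v Dv≡true)) (covers v)
  where
  filled : ∀ v → ∃[ y ] y ∈ L v × (D v ≡ true → y ≡ r v)
  filled v = fillRequest (L v) (proj₁ (K v)) (D v) (r v) (r∈L v)

  r′ : V (Ladder n) → ℕ
  r′ = proj₁ ∘ filled

  r′≡r : ∀ v → D v ≡ true → r′ v ≡ r v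
  r′≡r = proj₂ ∘ proj₂ ∘ filled

-- The Hall ratio and the lower bound

checkerboard : Fin 2 → ℕ → Bool
checkerboard j          (suc i) = not (checkerboard j i)
checkerboard zero       zero    = true
checkerboard (suc zero) zero    = false

checkerboard-rung : ∀ i → checkerboard zero i ≢ checkerboard (suc zero) i
checkerboard-rung zero    ()
checkerboard-rung (suc i) e = checkerboard-rung i (not-injective e)

checkerboard-proper : ∀ {n} u v → Adj (Ladder n) u v → restrict checkerboard u ≢ restrict checkerboard v
checkerboard-proper = restrict-proper checkerboard (λ _ _ → ≢-sym (not-¬ refl)) checkerboard-rung

ladder-irreflexive : ∀ {n} v → ¬ Adj (Ladder n) v v
ladder-irreflexive v v~v = checkerboard-proper v v v~v refl

rung-adjacent : ∀ {n} k → Adj (Ladder n) (zero , k) (suc zero , k)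
rung-adjacent k = inj₂ (refl , inj₁ refl)

row-adjacent : ∀ {m} j → Adj (Ladder (suc (suc m))) (j , zero) (j , suc zero)
row-adjacent j = inj₁ (refl , inj₁ refl)

firstRung : ∀ {m} → V (Ladder (suc m)) → Bool
firstRung (_ , zero)  = true
firstRung (_ , suc _) = false

corner : ∀ {m} → V (Ladder (suc m)) → Bool
corner (zero , zero) = true
corner (zero , suc _) = false
corner (suc _ , _)   = false

corner-off-rung : ∀ {m} j k → corner {m} (j , suc k) ≡ false
corner-off-rung zero       _ = refl
corner-off-rung (suc zero) _ = refl

size-firstRung : ∀ m (P : V (Ladder (suc m)) → Bool) → (∀ j k → P (j , suc k) ≡ false) →
  size (Ladder (suc m)) P ≡ indicator (P (zero , zero)) + indicator (P (suc zero , zero))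
size-firstRung m P off-rung = begin
  countTrue P ((zero , zero) ∷ tail zero ++ (suc zero , zero) ∷ tail (suc zero) ++ [])
    ≡⟨ countTrue-∷ P _ _ ⟩
  i₀ + countTrue P (tail zero ++ (suc zero , zero) ∷ tail (suc zero) ++ [])
    ≡⟨ cong (_+_ i₀) (countTrue-skip P _ (off zero)) ⟩
  i₀ + countTrue P ((suc zero , zero) ∷ tail (suc zero) ++ [])
    ≡⟨ cong (_+_ i₀) (countTrue-∷ P _ _) ⟩
  i₀ + (i₁ + countTrue P (tail (suc zero) ++ []))
    ≡⟨ cong (λ t → i₀ + (i₁ + t)) (countTrue-skip P [] (off (suc zero))) ⟩
  i₀ + (i₁ + 0)
    ≡⟨ cong (_+_ i₀) (+-identityʳ i₁) ⟩
  i₀ + i₁ ∎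
  where
  open ≡-Reasoning
  i₀ i₁ : ℕ
  i₀ = indicator (P (zero , zero))
  i₁ = indicator (P (suc zero , zero))
  tail : Fin 2 → List (V (Ladder (suc m)))
  tail j = map (j ,_) (tabulate suc)
  off : ∀ j → All (λ v → P v ≡ false) (tail j)
  off j = map⁺ (tabulate⁺ (off-rung j))

firstRungSubgraph : ∀ m → Subgraph (Ladder (suc m))
firstRungSubgraph m = record
  { S     = firstRung
  ; E     = λ u v → Adj (Ladder (suc m)) u v × firstRung u ≡ true × firstRung v ≡ true
  ; E⊆Adj = λ _ _ uv → uv }

firstRung-α≡1 : ∀ m → IsIndependenceNumber (Ladder (suc m)) (firstRungSubgraph m) 1
firstRung-α≡1 m = (corner , corner-independent , size-firstRung m corner corner-off-rung) , at-most-one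
  where
  corner-independent : IsIndependent (firstRungSubgraph m) corner
  corner-independent = on-rung , no-edge
    where
    on-rung : ∀ v → corner v ≡ true → firstRung v ≡ true
    on-rung (zero , zero) _ = refl
    no-edge : ∀ u v → corner u ≡ true → corner v ≡ true → ¬ E (firstRungSubgraph m) u v
    no-edge (zero , zero) (zero , zero) _ _ (loop , _) = ladder-irreflexive (zero , zero) loop

  at-most-one : ∀ I → IsIndependent (firstRungSubgraph m) I → size (Ladder (suc m)) I ≤ 1
  at-most-one I (I⊆S , no-edge) = subst (_≤ 1) (sym (size-firstRung m I off-rung))
    (both-not-true (I (zero , zero)) (I (suc zero , zero)) refl refl)
    where
    off-rung : ∀ j k → I (j , suc k) ≡ false
    off-rung j k with I (j , suc k) in Ijk
    ... | false = refl
    ... | true with () ← I⊆S (j , suc k) Ijk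
    both-not-true : ∀ a b → I (zero , zero) ≡ a → I (suc zero , zero) ≡ b → indicator a + indicator b ≤ 1
    both-not-true true  true  I₀ I₁ = contradiction (rung-adjacent zero , refl , refl) (no-edge _ _ I₀ I₁)
    both-not-true true  false _  _  = s≤s z≤n
    both-not-true false true  _  _  = s≤s z≤n
    both-not-true false false _  _  = z≤n

ladder-hallRatio : ∀ m → IsHallRatio (Ladder (suc m)) (+ 2 / 1)
ladder-hallRatio m =
  (firstRungSubgraph m , ((zero , zero) , refl) , 1 , firstRung-α≡1 m ,
   cong (λ s → ratio s 1) (sym (size-firstRung m firstRung (λ _ _ → refl)))) ,
  λ H _ → bipartite-ratio≤2 (Ladder (suc m)) (restrict checkerboard) checkerboard-proper H

ladder-not-1-flexible : ∀ m ε → ¬ Flexible (Ladder (suc m)) 1 ε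
ladder-not-1-flexible m ε flexible =
  let f , (f∈L , f-proper) , _ = flexible (λ _ → 0 ∷ []) (λ _ → refl , [] ∷ []) corner (λ _ → 0)
                                   (((zero , zero) , refl) , λ _ _ → here refl)
  in f-proper _ _ (rung-adjacent zero) (trans (only (f∈L _)) (sym (only (f∈L _))))
  where
  only : ∀ {x : ℕ} → x ∈ 0 ∷ [] → x ≡ 0
  only (here x≡0) = x≡0

-- Colouring the corner (0,0) with 1 forces (1,0) ↦ 0 and (1,1) ↦ 2, leaving no colour for (0,1).
blockingLists : ∀ {m} → V (Ladder (suc (suc m))) → List ℕ
blockingLists (zero     , zero)           = 0 ∷ 1 ∷ []
blockingLists (suc zero , zero)           = 0 ∷ 1 ∷ []
blockingLists (suc zero , suc zero)       = 0 ∷ 2 ∷ []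
blockingLists (zero     , suc zero)       = 1 ∷ 2 ∷ []
blockingLists (_        , suc (suc _))    = 0 ∷ 1 ∷ []

blockingLists-2-assignment : ∀ {m} → IsKAssignment (Ladder (suc (suc m))) 2 blockingLists
blockingLists-2-assignment (zero     , zero)        = refl , ((λ ()) ∷ []) ∷ [] ∷ []
blockingLists-2-assignment (suc zero , zero)        = refl , ((λ ()) ∷ []) ∷ [] ∷ []
blockingLists-2-assignment (suc zero , suc zero)    = refl , ((λ ()) ∷ []) ∷ [] ∷ []
blockingLists-2-assignment (zero     , suc zero)    = refl , ((λ ()) ∷ []) ∷ [] ∷ []
blockingLists-2-assignment (zero     , suc (suc _)) = refl , ((λ ()) ∷ []) ∷ [] ∷ []
blockingLists-2-assignment (suc zero , suc (suc _)) = refl , ((λ ()) ∷ []) ∷ [] ∷ []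

corner-blocked : ∀ {m} (f : V (Ladder (suc (suc m))) → ℕ) →
  IsProperLColoring (Ladder (suc (suc m))) blockingLists f → f (zero , zero) ≢ 1
corner-blocked f (f∈L , f-proper) f₀₀≡1
  with f∈L (suc zero , zero) | f∈L (suc zero , suc zero) | f∈L (zero , suc zero)
... | there (here f₁₀≡1) | _                  | _ =
  f-proper _ _ (rung-adjacent zero) (trans f₀₀≡1 (sym f₁₀≡1))
... | here f₁₀≡0         | here f₁₁≡0         | _ =
  f-proper _ _ (row-adjacent (suc zero)) (trans f₁₀≡0 (sym f₁₁≡0))
... | here _             | there (here f₁₁≡2) | here f₀₁≡1 =
  f-proper _ _ (row-adjacent zero) (trans f₀₀≡1 (sym f₀₁≡1))
... | here _             | there (here f₁₁≡2) | there (here f₀₁≡2) =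
  f-proper _ _ (rung-adjacent (suc zero)) (trans f₀₁≡2 (sym f₁₁≡2))

ladder-not-2-flexible : ∀ m → ¬ Flexible (Ladder (suc (suc m))) 2 ½
ladder-not-2-flexible m flexible =
  let f , f-proper , ½≤hits = flexible blockingLists blockingLists-2-assignment corner (λ _ → 1)
                                (((zero , zero) , refl) , request∈)
  in ½*1≰0 (subst₂ (λ d h → ½ ℚ.* ℕtoℚ d ℚ.≤ ℕtoℚ h)
              size-corner (no-hits f (corner-blocked f f-proper)) ½≤hits)
  where
  request∈ : ∀ v → corner v ≡ true → 1 ∈ blockingLists v
  request∈ (zero , zero) _ = there (here refl)

  size-corner : size (Ladder (suc (suc m))) corner ≡ 1
  size-corner = size-firstRung (suc m) corner corner-off-rung

  no-hits : (f : V (Ladder (suc (suc m))) → ℕ) → f (zero , zero) ≢ 1 →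
    size (Ladder (suc (suc m))) (λ v → corner v ∧ (f v ≡ᵇ 1)) ≡ 0
  no-hits f f₀₀≢1 =
    trans (size-firstRung (suc m) (λ v → corner v ∧ (f v ≡ᵇ 1))
                          (λ j k → cong (_∧ (f (j , suc k) ≡ᵇ 1)) (corner-off-rung j k)))
          (cong (λ b → indicator b + 0) (≢⇒≡ᵇ-false f₀₀≢1))

proposition8 : (n : ℕ) → 2 ≤ n →
    Flexible (Path 2 □ Path n) 3 (+ 1 / 2) × ListFlexNumberIs (Path 2 □ Path n) 3
proposition8 (suc (suc m)) (s≤s (s≤s z≤n)) =
  ladder-flexible _ , (+ 2 / 1 , ladder-hallRatio (suc m) , _ , s≤s z≤n , ladder-flexible _ , fewer-colours)
  where
  fewer-colours : ∀ j → 1 ≤ j → j < 3 → ¬ Flexible (Ladder (suc (suc m))) j ½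
  fewer-colours 1 _ _ = ladder-not-1-flexible (suc m) ½
  fewer-colours 2 _ _ = ladder-not-2-flexible m
  fewer-colours (suc (suc (suc _))) _ (s≤s (s≤s (s≤s ())))
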